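{- In the cyclic prefix-free parsing setting described in the context, let $T_g, T_h \in \mathcal{M}$, $i$ a position of $T_g$ and $j$ a position of $T_h$. If $\alpha(\mathrm{conj}_i(T_g)) <_{\mathrm{lex}} \alpha(\mathrm{conj}_j(T_h))$, then $\mathrm{conj}_i(T_g) \prec_\omega \mathrm{conj}_j(T_h)$.
   Context: Notation: $\mathrm{conj}_i(T) = T[i..n]T[1..i-1]$; strings are viewed cyclically. $<_{\mathrm{lex}}$ is lexicographic order. Every string $X$ equals $\mathrm{root}(X)^{\exp(X)}$ with $\mathrm{root}(X)$ primitive; $X \prec_\omega Y$ if $\mathrm{root}(X)=\mathrm{root}(Y)$ and $\exp(X)<\exp(Y)$, or $X^\omega <_{\mathrm{lex}} Y^\omega$ ($X^\omega = XXX\cdots$). Cyclic prefix-free parsing: fix an integer $w\ge1$ and a set $E$ of strings of length $w$ (trigger strings). $\mathcal M = \{T_1,\ldots,T_m\}$ is a multiset of strings, each regarded as circular, each of length at least $w$ and containing at least one occurrence of a trigger string as a cyclic factor. A phrase of $T_h$ is a cyclic factor (read circularly, possibly wrapping around) of length $>w$ that starts at an occurrence of a trigger string, ends with the next (cyclically) occurrence of a trigger string, and has no internal occurrence of a trigger string; consecutive phrases of $T_h$ overlap in exactly $w$ characters. The dictionary $D = \{D_1 <_{\mathrm{lex}} \cdots <_{\mathrm{lex}} D_{|D|}\}$ is the set of distinct phrases of all strings of $\mathcal M$, sorted lexicographically. The parse $P_h = P_h[1..p_h]$ of $T_h$ is the cyclic sequence of lexicographic ranks in $D$ of the consecutive phrases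 of $T_h$. $\mathcal S$ denotes the set of suffixes of phrases of $D$ of length greater than $w$. Each position $j$ of $T_h$ is assigned to the phrase occurrence whose starting trigger occurrence is the last one starting at or before $j$ (cyclically); if this is the $i$-th phrase of $P_h$ and $T_h[j]$ is its $k$-th character ($1\le k\le |D_{P_h[i]}|-w$), set $\delta(T_h[j]) = (i,k)$ (position and offset). Then $\alpha(\mathrm{conj}_j(T_h))$ is the suffix of $D_{P_h[i]}$ starting at offset $k$; it is an element of $\mathcal S$ and a prefix of $(\mathrm{conj}_j(T_h))^\omega$. -}

module Defs where

open import Level using (0ℓ)
open import Data.Nat using (ℕ; zero; suc; _+_; _∸_; _<_; _≤_)
open import Data.List using (List; []; _∷_; _++_; [_]; concat; replicate; drop; length)
open import Data.Product using (Σ; ∃; _×_; _,_)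
open import Data.Sum using (_⊎_)
open import Relation.Binary.Core using (Rel)
open import Relation.Binary.PropositionalEquality using (_≡_; _≢_)
open import Relation.Nullary using (¬_)
open import Data.List.Relation.Binary.Lex.Strict using (Lex-<)

-- Strings are lists; positions are 0-based (position p here = p+1 in the paper).

rot1 : {A : Set} → List A → List A
rot1 []       = []
rot1 (x ∷ xs) = xs ++ [ x ]

conj : {A : Set} → ℕ → List A → List A
conj zero    T = T
conj (suc i) T = conj i (rot1 T)

-- omegaTake X ℓ = prefix of length ℓ of X^ω  (for X nonempty)
omegaTake : {A : Set} → List A → ℕ → List A
omegaTake []       _       = []
omegaTake (x ∷ xs) zero    = []
omegaTake (x ∷ xs) (suc ℓ) = x ∷ omegaTake (xs ++ [ x ]) ℓ

cycFactor : {A : Set} → List A → ℕ → ℕ → List A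
cycFactor T p ℓ = omegaTake (conj p T) ℓ

pow : {A : Set} → List A → ℕ → List A
pow X e = concat (replicate e X)

Primitive : {A : Set} → List A → Set
Primitive R = R ≢ [] × (∀ U k → R ≡ pow U k → k ≡ 1)

-- X^ω <_lex Y^ω : some prefixes of equal length are lexicographically ordered
OmegaLess : {A : Set} → Rel A 0ℓ → List A → List A → Set
OmegaLess _<ᴬ_ X Y = ∃ λ k → Lex-< _≡_ _<ᴬ_ (omegaTake X k) (omegaTake Y k)

-- X ≺ω Y : (root X = root Y and exp X < exp Y) or X^ω <lex Y^ω.
-- "root X = R, exp X = a" is expressed as: R primitive and X ≡ R^a
-- (the primitive root and exponent are unique).
PrecOmega : {A : Set} → Rel A 0ℓ → List A → List A → Set
PrecOmega _<ᴬ_ X Y =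
  (Σ _ λ R → ∃ λ a → ∃ λ b →
     Primitive R × X ≡ pow R a × Y ≡ pow R b × a < b)
  ⊎ OmegaLess _<ᴬ_ X Y

Trig : {A : Set} → (List A → Set) → ℕ → List A → ℕ → Set
Trig E w T p = E (cycFactor T p w)

-- IsAlpha E w T j s : s = α(conj_j(T)).
-- e : distance back from j to the last trigger occurrence p at or before j
--     (cyclically), so the offset of j in its phrase is e (0-based);
-- d : distance from p to the next trigger occurrence (cyclically, d ≥ 1);
-- the phrase is the cyclic factor of length d + w starting at p,
-- and α is its suffix starting at offset e.
IsAlpha : {A : Set} → (List A → Set) → ℕ → List A → ℕ → List A → Set
IsAlpha E w T j s =
  ∃ λ e → ∃ λ d →
    let n = length T
        p = (j + n) ∸ e
    in e < n
     × Trig E w T p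
     × (∀ e′ → e′ < e → ¬ Trig E w T ((j + n) ∸ e′))
     × 1 ≤ d
     × Trig E w T (p + d)
     × (∀ d′ → 1 ≤ d′ → d′ < d → ¬ Trig E w T (p + d′))
     × s ≡ drop e (cycFactor T p (d + w))

{-# OPTIONS --safe #-}
-- The suffix α(X) of a rotation X is the prefix of X^ω that ends with the
-- first trigger occurrence at a positive offset of X.  If α(X) and α(Y)
-- differ at some position, that position already orders X^ω and Y^ω.
-- Otherwise α(X) is a proper prefix of α(Y); then Y^ω agrees with X^ω up to
-- the end of the trigger occurrence closing α(X), so Y has a trigger
-- occurrence strictly before the one closing α(Y), which is impossible.
module Submission where

open import Defs
open import Level using (0ℓ)
open import Data.Nat using (ℕ; zero; suc; _+_; _∸_; _<_; _≤_; z≤n; s≤s; _≤?_)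
open import Data.Nat.Properties
  using ( +-assoc; +-comm; ≤-trans; <⇒≤; ≰⇒>; m≤n+m; m<m+n; +-monoʳ-<; +-cancelʳ-<
        ; ∸-monoʳ-<; m<n⇒0<n; m<n⇒0<n∸m; m+n∸n≡m; m+[n∸m]≡n; m∸n+n≡m )
open import Data.Fin using (Fin)
open import Data.List using (List; []; _∷_; _++_; [_]; length; lookup; take; drop)
open import Data.List.Properties using (++-assoc; ++-identityʳ; length-++; length-++-≤ˡ; take-[]; drop-[])
open import Data.Product using (∃; _×_; _,_)
open import Data.Sum using (_⊎_; inj₁; inj₂)
open import Data.Empty using (⊥-elim)
open import Relation.Binary.Core using (Rel)
open import Relation.Binary.Structures using (IsStrictTotalOrder)
open import Relation.Binary.PropositionalEquality
  using (_≡_; refl; sym; trans; cong; subst; subst₂; module ≡-Reasoning)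
open import Relation.Nullary using (¬_; yes; no)
open import Data.List.Membership.Propositional using (_∈_)
open import Data.List.Relation.Binary.Lex.Core using (base; halt; this; next)
open import Data.List.Relation.Binary.Lex.Strict using (Lex-<)

module _ {A : Set} where

  conj-[] : ∀ k → conj {A} k [] ≡ []
  conj-[] zero    = refl
  conj-[] (suc k) = conj-[] k

  conj-+ : ∀ b c (X : List A) → conj (b + c) X ≡ conj c (conj b X)
  conj-+ zero    c X = refl
  conj-+ (suc b) c X = conj-+ b c (rot1 X)

  conj-++ : ∀ (xs ys : List A) → conj (length xs) (xs ++ ys) ≡ ys ++ xs
  conj-++ []       ys = sym (++-identityʳ ys)
  conj-++ (x ∷ xs) ys = begin
    conj (length xs) ((xs ++ ys) ++ [ x ])  ≡⟨ cong (conj (length xs)) (++-assoc xs ys [ x ]) ⟩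
    conj (length xs) (xs ++ (ys ++ [ x ]))  ≡⟨ conj-++ xs (ys ++ [ x ]) ⟩
    (ys ++ [ x ]) ++ xs                     ≡⟨ ++-assoc ys [ x ] xs ⟩
    ys ++ x ∷ xs                            ∎
    where open ≡-Reasoning

  conj-length : ∀ (X : List A) → conj (length X) X ≡ X
  conj-length X = trans (cong (conj (length X)) (sym (++-identityʳ X))) (conj-++ X [])

  conj-periodic : ∀ i (X : List A) → conj (i + length X) X ≡ conj i X
  conj-periodic i X = begin
    conj (i + length X) X      ≡⟨ cong (λ q → conj q X) (+-comm i (length X)) ⟩
    conj (length X + i) X      ≡⟨ conj-+ (length X) i X ⟩
    conj i (conj (length X) X) ≡⟨ cong (conj i) (conj-length X) ⟩
    conj i X                   ∎
    where open ≡-Reasoning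

  length-rot1 : ∀ (X : List A) → length (rot1 X) ≡ length X
  length-rot1 []       = refl
  length-rot1 (x ∷ xs) = trans (length-++ xs) (+-comm (length xs) 1)

  length-conj : ∀ k (X : List A) → length (conj k X) ≡ length X
  length-conj zero    X = refl
  length-conj (suc k) X = trans (length-conj k (rot1 X)) (length-rot1 X)

  0<length-conj : ∀ k (T : List A) → k < length T → 0 < length (conj k T)
  0<length-conj k T k<|T| = subst (0 <_) (sym (length-conj k T)) (m<n⇒0<n k<|T|)

  cycFactor-+ : ∀ (T : List A) p c ℓ → cycFactor T (p + c) ℓ ≡ cycFactor (conj p T) c ℓ
  cycFactor-+ T p c ℓ = cong (λ Z → omegaTake Z ℓ) (conj-+ p c T)

  length-omegaTake : ∀ (X : List A) ℓ → 0 < length X → length (omegaTake X ℓ) ≡ ℓ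
  length-omegaTake (x ∷ xs) zero    _ = refl
  length-omegaTake (x ∷ xs) (suc ℓ) _ =
    cong suc (length-omegaTake (rot1 (x ∷ xs)) ℓ
               (subst (0 <_) (sym (length-rot1 (x ∷ xs))) (s≤s z≤n)))

  take-omegaTake : ∀ (X : List A) {m ℓ} → m ≤ ℓ → take m (omegaTake X ℓ) ≡ omegaTake X m
  take-omegaTake []       {m} _         = take-[] m
  take-omegaTake (x ∷ xs) z≤n           = refl
  take-omegaTake (x ∷ xs) (s≤s m≤ℓ)    = cong (x ∷_) (take-omegaTake (xs ++ [ x ]) m≤ℓ)

  drop-omegaTake : ∀ (X : List A) k ℓ → drop k (omegaTake X (k + ℓ)) ≡ omegaTake (conj k X) ℓ
  drop-omegaTake []       k       ℓ = trans (drop-[] k) (cong (λ Y → omegaTake Y ℓ) (sym (conj-[] k)))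
  drop-omegaTake (x ∷ xs) zero    ℓ = refl
  drop-omegaTake (x ∷ xs) (suc k) ℓ = drop-omegaTake (xs ++ [ x ]) k ℓ

  omegaTake-≡⇒cycFactor-≡ : ∀ (X Y : List A) k ℓ →
    omegaTake X (k + ℓ) ≡ omegaTake Y (k + ℓ) → cycFactor X k ℓ ≡ cycFactor Y k ℓ
  omegaTake-≡⇒cycFactor-≡ X Y k ℓ eq = begin
    omegaTake (conj k X) ℓ     ≡⟨ sym (drop-omegaTake X k ℓ) ⟩
    drop k (omegaTake X (k + ℓ)) ≡⟨ cong (drop k) eq ⟩
    drop k (omegaTake Y (k + ℓ)) ≡⟨ drop-omegaTake Y k ℓ ⟩
    omegaTake (conj k Y) ℓ     ∎
    where open ≡-Reasoning

  take-length-++ : ∀ (xs ys : List A) → take (length xs) (xs ++ ys) ≡ xs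
  take-length-++ []       ys = refl
  take-length-++ (x ∷ xs) ys = cong (x ∷_) (take-length-++ xs ys)

  Lex-<⇒mismatch⊎strictPrefix : ∀ {_<ᴬ_ : Rel A 0ℓ} (xs ys : List A) → Lex-< _≡_ _<ᴬ_ xs ys →
    (∃ λ m → m ≤ length xs × m ≤ length ys × Lex-< _≡_ _<ᴬ_ (take m xs) (take m ys))
    ⊎ (∃ λ z → ∃ λ zs → ys ≡ xs ++ z ∷ zs)
  Lex-<⇒mismatch⊎strictPrefix []       []       (base ())
  Lex-<⇒mismatch⊎strictPrefix []       (y ∷ ys) halt     = inj₂ (y , ys , refl)
  Lex-<⇒mismatch⊎strictPrefix (x ∷ xs) (y ∷ ys) (this p) = inj₁ (1 , s≤s z≤n , s≤s z≤n , this p)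
  Lex-<⇒mismatch⊎strictPrefix (x ∷ xs) (y ∷ ys) (next refl xs<ys)
    with Lex-<⇒mismatch⊎strictPrefix xs ys xs<ys
  ... | inj₁ (m , m≤xs , m≤ys , lt) = inj₁ (suc m , s≤s m≤xs , s≤s m≤ys , next refl lt)
  ... | inj₂ (z , zs , eq)          = inj₂ (z , zs , cong (x ∷_) eq)

module _ {A : Set} (E : List A → Set) (w : ℕ) where

  -- α(X) for a rotation X, seen from X alone: only the end of the phrase,
  -- the first trigger occurrence at a positive offset of X, matters.
  record PhraseSuffix (X s : List A) : Set where
    field
      dist       : ℕ
      1≤dist     : 1 ≤ dist
      trigger    : Trig E w X dist
      no-trigger : ∀ k → 1 ≤ k → k < dist → ¬ Trig E w X k
      s≡         : s ≡ omegaTake X (dist + w)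

  IsAlpha⇒PhraseSuffix : ∀ (T : List A) j s → IsAlpha E w T j s → PhraseSuffix (conj j T) s
  IsAlpha⇒PhraseSuffix T j s (e , d , e<n , _ , no-trig-before , 1≤d , trig-next , no-trig-between , s≡drop) =
    record
      { dist       = k
      ; 1≤dist     = m<n⇒0<n∸m e<d
      ; trigger    = subst E (trans (cong (λ q → cycFactor T (p + q) w) (sym e+k≡d)) (window k))
                       trig-next
      ; no-trigger = λ k′ 1≤k′ k′<k trig →
          no-trig-between (e + k′) (≤-trans 1≤k′ (m≤n+m k′ e))
            (subst (e + k′ <_) e+k≡d (+-monoʳ-< e k′<k))
            (subst E (sym (window k′)) trig)
      ; s≡         = begin
          s                                  ≡⟨ s≡drop ⟩
          drop e (omegaTake Y (d + w))       ≡⟨ cong (λ q → drop e (omegaTake Y (q + w))) (sym e+k≡d) ⟩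
          drop e (omegaTake Y (e + k + w))   ≡⟨ cong (λ q → drop e (omegaTake Y q)) (+-assoc e k w) ⟩
          drop e (omegaTake Y (e + (k + w))) ≡⟨ drop-omegaTake Y e (k + w) ⟩
          omegaTake (conj e Y) (k + w)       ≡⟨ cong (λ Z → omegaTake Z (k + w)) (sym conj-j≡) ⟩
          omegaTake (conj j T) (k + w)       ∎
      }
    where
    open ≡-Reasoning
    n = length T
    p = (j + n) ∸ e
    Y = conj p T
    p+e≡j+n : p + e ≡ j + n
    p+e≡j+n = m∸n+n≡m (≤-trans (<⇒≤ e<n) (m≤n+m n j))
    conj-j≡ : conj j T ≡ conj e Y
    conj-j≡ = trans (sym (conj-periodic j T))
           (trans (cong (λ q → conj q T) (sym p+e≡j+n)) (conj-+ p e T))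
    window : ∀ c → cycFactor T (p + (e + c)) w ≡ cycFactor (conj j T) c w
    window c = trans (cycFactor-+ T p (e + c) w)
                 (trans (cycFactor-+ Y e c w) (cong (λ Z → cycFactor Z c w) (sym conj-j≡)))
    -- The phrase containing j extends past j: a trigger at p + d ≤ j + n
    -- would be a later trigger at or before j than the one at p.
    e<d : e < d
    e<d with d ≤? e
    ... | no d≰e  = ≰⇒> d≰e
    ... | yes d≤e = ⊥-elim (no-trig-before (e ∸ d) (∸-monoʳ-< 1≤d d≤e)
                              (subst (Trig E w T) (sym back≡p+d) trig-next))
      where
      back≡p+d : (j + n) ∸ (e ∸ d) ≡ p + d
      back≡p+d = begin
        (j + n) ∸ (e ∸ d)             ≡⟨ cong (_∸ (e ∸ d)) (sym p+e≡j+n) ⟩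
        (p + e) ∸ (e ∸ d)             ≡⟨ cong (λ q → (p + q) ∸ (e ∸ d)) (sym (m+[n∸m]≡n d≤e)) ⟩
        (p + (d + (e ∸ d))) ∸ (e ∸ d) ≡⟨ cong (_∸ (e ∸ d)) (sym (+-assoc p d (e ∸ d))) ⟩
        (p + d + (e ∸ d)) ∸ (e ∸ d)   ≡⟨ m+n∸n≡m (p + d) (e ∸ d) ⟩
        p + d                         ∎
    k = d ∸ e
    e+k≡d : e + k ≡ d
    e+k≡d = m+[n∸m]≡n (<⇒≤ e<d)

  module _ {X s : List A} (0<|X| : 0 < length X) (σ : PhraseSuffix X s) where
    open PhraseSuffix σ

    length-phraseSuffix : length s ≡ dist + w
    length-phraseSuffix = trans (cong length s≡) (length-omegaTake X (dist + w) 0<|X|)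

    take-phraseSuffix : ∀ {m} → m ≤ length s → take m s ≡ omegaTake X m
    take-phraseSuffix m≤s =
      trans (cong (take _) s≡) (take-omegaTake X (subst (_ ≤_) length-phraseSuffix m≤s))

  phraseSuffix-strictPrefix : ∀ {X Y s z zs} → 0 < length X → 0 < length Y →
    PhraseSuffix X s → ¬ PhraseSuffix Y (s ++ z ∷ zs)
  phraseSuffix-strictPrefix {X} {Y} {s} {z} {zs} 0<|X| 0<|Y| σ τ =
    τ.no-trigger σ.dist σ.1≤dist dist<dist
      (subst E (omegaTake-≡⇒cycFactor-≡ X Y σ.dist w X≈Y) σ.trigger)
    where
    module σ = PhraseSuffix σ
    module τ = PhraseSuffix τ
    |s|≡ : length s ≡ σ.dist + w
    |s|≡ = length-phraseSuffix 0<|X| σ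
    X≈Y : omegaTake X (σ.dist + w) ≡ omegaTake Y (σ.dist + w)
    X≈Y = begin
      omegaTake X (σ.dist + w)      ≡⟨ sym σ.s≡ ⟩
      s                             ≡⟨ sym (take-length-++ s (z ∷ zs)) ⟩
      take (length s) (s ++ z ∷ zs) ≡⟨ take-phraseSuffix 0<|Y| τ (length-++-≤ˡ s) ⟩
      omegaTake Y (length s)        ≡⟨ cong (omegaTake Y) |s|≡ ⟩
      omegaTake Y (σ.dist + w)      ∎
      where open ≡-Reasoning
    dist<dist : σ.dist < τ.dist
    dist<dist = +-cancelʳ-< w σ.dist τ.dist
      (subst₂ _<_ |s|≡ (trans (sym (length-++ s)) (length-phraseSuffix 0<|Y| τ))
        (m<m+n (length s) (s≤s z≤n)))

  phraseSuffix-Lex-<⇒OmegaLess : ∀ {_<ᴬ_ : Rel A 0ℓ} {X Y s t} → 0 < length X → 0 < length Y →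
    PhraseSuffix X s → PhraseSuffix Y t → Lex-< _≡_ _<ᴬ_ s t → OmegaLess _<ᴬ_ X Y
  phraseSuffix-Lex-<⇒OmegaLess {s = s} {t} 0<|X| 0<|Y| σ τ s<t
    with Lex-<⇒mismatch⊎strictPrefix s t s<t
  ... | inj₁ (m , m≤s , m≤t , lt) =
    m , subst₂ (Lex-< _≡_ _) (take-phraseSuffix 0<|X| σ m≤s) (take-phraseSuffix 0<|Y| τ m≤t) lt
  ... | inj₂ (z , zs , refl) = ⊥-elim (phraseSuffix-strictPrefix 0<|X| 0<|Y| σ τ)

lemma6 : {A : Set} (_<ᴬ_ : Rel A 0ℓ) → IsStrictTotalOrder _≡_ _<ᴬ_ →
    (w : ℕ) → 1 ≤ w →
    (E : List A → Set) → (∀ s → E s → length s ≡ w) →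
    (M : List (List A)) →
    (∀ T → T ∈ M → w ≤ length T) →
    (∀ T → T ∈ M → ∃ λ p → p < length T × Trig E w T p) →
    (g h : Fin (length M)) (i j : ℕ) →
    i < length (lookup M g) → j < length (lookup M h) →
    (s₁ s₂ : List A) →
    IsAlpha E w (lookup M g) i s₁ → IsAlpha E w (lookup M h) j s₂ →
    Lex-< _≡_ _<ᴬ_ s₁ s₂ →
    PrecOmega _<ᴬ_ (conj i (lookup M g)) (conj j (lookup M h))
lemma6 _<ᴬ_ _ w _ E _ M _ _ g h i j i<|Tg| j<|Th| s₁ s₂ α₁ α₂ s₁<s₂ =
  inj₂ (phraseSuffix-Lex-<⇒OmegaLess E w
         (0<length-conj i (lookup M g) i<|Tg|) (0<length-conj j (lookup M h) j<|Th|)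
         (IsAlpha⇒PhraseSuffix E w (lookup M g) i s₁ α₁)
         (IsAlpha⇒PhraseSuffix E w (lookup M h) j s₂ α₂)
         s₁<s₂)
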